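{- Let $k\ge 4$ and let $G_k$, $G_{k+1}$ be the graphs defined below (for $\ell=2$). Define $\omega(0)=0$ and $\omega(m)=m+2^{k-1}$ for $IV_b^k\le m\le II_t^k$. Then $\omega$ is a color-preserving graph isomorphism from $B_2\cup B_3\cup B_4$ of $G_k$ (the induced subgraph of $G_k$ on $\{0\}\cup\{IV_b^k,\ldots,II_t^k\}$) onto $B_4$ of $G_{k+1}$.
   Context: The pruning function $\operatorname{P}_{2}:\mathbb{Z}_{>0}\to\mathbb{Z}_{\geq 0}$: write $m$ in binary, padded on the left with zeros as needed, let $z$ be the position (position $0$ = least significant bit) of the second zero bit counted from the right, let $q = 2^{z}\lfloor m/2^{z}\rfloor$, and set $\operatorname{P}_2(m)=\max(q-1,0)$. For an integer $k\ge 2$, $G_k$ is the directed graph with node set $\{0\}\cup\{2^{k-1}-1,\ldots,2^k-1\}$ and edges: for each $m$ with $2^{k-1}-1\le m<2^k-1$, a "blue" edge from $m$ to $m+1$ (weight $-1$) and a "red" edge from $\operatorname{P}_2(m)$ to $m$ (weight $+1$). For $k\ge 4$ set $I_t^k=2^k-1$, $I_b^k=2^k-2^{k-2}-1$, $II_t^k=2^k-2^{k-2}-2$, $II_b^k=2^k-2^{k-2}-2^{k-4}-1$, $III_t^k=2^k-2^{k-2}-2^{k-4}-2$, $III_b^k=2^k-2^{k-2}-2^{k-3}-1$, $IV_t^k=2^k-2^{k-2}-2^{k-3}-2$, $IV_b^k=2^{k-1}-1$. For $X\in\{I,II,III,IV\}$, the box $B_j$ ($j=1,2,3,4$ respectively)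 of $G_k$ is the induced subgraph of $G_k$ on $\{0\}\cup\{X_b^k,\ldots,X_t^k\}$. -}

module Defs where

open import Data.Nat using (ℕ; zero; suc; _+_; _*_; _∸_; _^_; _≤_; _<_)
open import Data.Nat.DivMod using (_/_; _%_)
open import Data.Nat.Properties using (_≟_)
open import Data.Product using (_×_; ∃)
open import Data.Sum using (_⊎_)
open import Function.Bundles using (_⇔_)
open import Relation.Binary.PropositionalEquality using (_≡_)
open import Relation.Nullary using (yes; no)

-- nthZero fuel n m : position (0 = least significant bit) of the
-- (n+1)-th zero bit of m, counted from the right (m padded on the left
-- with infinitely many zeros).  The fuel only serves termination; with
-- fuel ≥ m + n + 1 the result is exact (each step either halves m or
-- decreases n).
nthZero : ℕ → ℕ → ℕ → ℕ
nthZero zero    n       m = n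
nthZero (suc f) n       m with m % 2 ≟ 0
nthZero (suc f) zero    m | yes _ = 0
nthZero (suc f) (suc n) m | yes _ = suc (nthZero f n (m / 2))
nthZero (suc f) n       m | no  _ = suc (nthZero f n (m / 2))

secondZero : ℕ → ℕ
secondZero m = nthZero (m + 2) 1 m

P₂ : ℕ → ℕ
P₂ m = (2 ^ z) * (m / (2 ^ z)) ∸ 1
  where
  z = secondZero m
  instance
    _ : Data.Nat.NonZero (2 ^ z)
    _ = Data.Nat.Properties.m^n≢0 2 z

data Color : Set where
  blue red : Color

record Graph : Set₁ where
  field
    Node : ℕ → Set
    Edge : Color → ℕ → ℕ → Set
open Graph public

Induced : Graph → (ℕ → Set) → Graph
Induced G S = record
  { Node = λ m → Node G m × S m
  ; Edge = λ c a b → Edge G c a b × S a × S b }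

IsColorIso : Graph → Graph → (ℕ → ℕ) → Set
IsColorIso G H f =
    (∀ m → Node G m → Node H (f m))
  × (∀ a b → Node G a → Node G b → f a ≡ f b → a ≡ b)
  × (∀ n → Node H n → ∃ λ m → Node G m × f m ≡ n)
  × (∀ c a b → Node G a → Node G b → Edge G c a b ⇔ Edge H c (f a) (f b))

G : ℕ → Graph
G k = record
  { Node = λ m → m ≡ 0 ⊎ (2 ^ (k ∸ 1) ∸ 1 ≤ m × m ≤ 2 ^ k ∸ 1)
  ; Edge = E }
  where
  E : Color → ℕ → ℕ → Set
  E blue a b = (2 ^ (k ∸ 1) ∸ 1 ≤ a × a < 2 ^ k ∸ 1) × b ≡ suc a
  E red  a b = (2 ^ (k ∸ 1) ∸ 1 ≤ b × b < 2 ^ k ∸ 1) × a ≡ P₂ b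

I-t I-b II-t II-b III-t III-b IV-t IV-b : ℕ → ℕ
I-t   k = 2 ^ k ∸ 1
I-b   k = 2 ^ k ∸ 2 ^ (k ∸ 2) ∸ 1
II-t  k = 2 ^ k ∸ 2 ^ (k ∸ 2) ∸ 2
II-b  k = 2 ^ k ∸ 2 ^ (k ∸ 2) ∸ 2 ^ (k ∸ 4) ∸ 1
III-t k = 2 ^ k ∸ 2 ^ (k ∸ 2) ∸ 2 ^ (k ∸ 4) ∸ 2
III-b k = 2 ^ k ∸ 2 ^ (k ∸ 2) ∸ 2 ^ (k ∸ 3) ∸ 1
IV-t  k = 2 ^ k ∸ 2 ^ (k ∸ 2) ∸ 2 ^ (k ∸ 3) ∸ 2
IV-b  k = 2 ^ (k ∸ 1) ∸ 1

Span : ℕ → ℕ → ℕ → Set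
Span lo hi m = m ≡ 0 ⊎ (lo ≤ m × m ≤ hi)

B₄ : ℕ → Graph
B₄ k = Induced (G k) (Span (IV-b k) (IV-t k))

B₂₃₄ : ℕ → Graph
B₂₃₄ k = Induced (G k) (Span (IV-b k) (II-t k))

ω : ℕ → ℕ → ℕ
ω k zero    = 0
ω k (suc m) = suc m + 2 ^ (k ∸ 1)

-- Away from 0, ω is translation by 2^(k-1), so it carries the blue edges m → m+1 of B₂ ∪ B₃ ∪ B₄
-- onto those of B₄ of G_{k+1}, and only the red edges P₂ b → b need an argument. Every node
-- b ≠ 0 of B₂ ∪ B₃ ∪ B₄ other than 2^(k-1) - 1 is y + 2^(k-1) with y + 2 ≤ 2^(k-2), so the second
-- zero of b lies below bit k-1; translating by multiples of 2^(k-1) leaves those bits alone,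
-- whence P₂ (b + 2^(k-1)) = P₂ b + 2^(k-1). The node 2^(k-1) - 1 and its image 2^k - 1 are
-- all ones and are both pruned to 0 = ω 0. So P₂ ∘ ω = ω ∘ P₂ on B₂ ∪ B₃ ∪ B₄, and injectivity of
-- ω makes it reflect red edges as well.

module Submission where

open import Defs
open import Data.Nat
open import Data.Nat.Properties
open import Data.Nat.DivMod
open import Data.Nat.Divisibility using (divides-refl)
open import Data.Nat.Tactic.RingSolver using (solve-∀)
open import Data.Product using (_×_; _,_; proj₁; proj₂; ∃)
open import Data.Sum using (inj₁; inj₂)
open import Function using (_∘_)
open import Function.Bundles using (_⇔_; mk⇔; module Equivalence)
import Function.Properties.Equivalence as ⇔
open import Relation.Binary.PropositionalEquality
open import Relation.Nullary using (yes; no; contradiction)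

data ParityView : ℕ → Set where
  even : ∀ q → ParityView (q * 2)
  odd  : ∀ q → ParityView (1 + q * 2)

parityView : ∀ m → ParityView m
parityView zero = even 0
parityView (suc m) with parityView m
... | even q = odd q
... | odd q  = even (suc q)

nthZero-even-zero : ∀ f q → nthZero (suc f) 0 (q * 2) ≡ 0
nthZero-even-zero f q with (q * 2) % 2 ≟ 0
... | yes _   = refl
... | no  ≢0  = contradiction ([m+kn]%n≡m%n 0 q 2) ≢0

nthZero-even-suc : ∀ f n q → nthZero (suc f) (suc n) (q * 2) ≡ suc (nthZero f n q)
nthZero-even-suc f n q with (q * 2) % 2 ≟ 0
... | yes _   = cong (suc ∘ nthZero f n) (m*n/n≡m q 2)
... | no  ≢0  = contradiction ([m+kn]%n≡m%n 0 q 2) ≢0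

nthZero-odd : ∀ f n q → nthZero (suc f) n (1 + q * 2) ≡ suc (nthZero f n q)
nthZero-odd f n q with (1 + q * 2) % 2 ≟ 0
... | yes ≡0 = contradiction (trans (sym ([m+kn]%n≡m%n 1 q 2)) ≡0) λ ()
... | no  _  = cong (suc ∘ nthZero f n) (trans (+-distrib-/-∣ʳ 1 {d = 2} (divides-refl q)) (m*n/n≡m q 2))

n<2^n : ∀ n → n < 2 ^ n
n<2^n zero    = s≤s z≤n
n<2^n (suc n) = begin-strict
  suc n               ≡⟨ +-comm 1 n ⟩
  n + 1               <⟨ +-monoˡ-< 1 (n<2^n n) ⟩
  2 ^ n + 1           ≤⟨ +-monoʳ-≤ (2 ^ n) (m≤n⇒m≤n+o 0 (m^n>0 2 n)) ⟩
  2 ^ n + (2 ^ n + 0) ∎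
  where open ≤-Reasoning

halve-< : ∀ q p → q * 2 < 2 * p → q < p
halve-< q p q*2<2p = *-cancelʳ-< 2 q p (subst (q * 2 <_) (*-comm 2 p) q*2<2p)

halve-fuel : ∀ q n f → q * 2 + n < f → q + n < f
halve-fuel q n f = ≤-<-trans (+-monoˡ-≤ n (m≤m*n q 2))

*2-+-2^* : ∀ q j d → q * 2 + 2 ^ suc j * d ≡ (q + 2 ^ j * d) * 2
*2-+-2^* q j d = q*2+2*p*d≡[q+p*d]*2 q (2 ^ j) d
  where q*2+2*p*d≡[q+p*d]*2 : ∀ q p d → q * 2 + 2 * p * d ≡ (q + p * d) * 2
        q*2+2*p*d≡[q+p*d]*2 = solve-∀

nthZero-+-2^* : ∀ f f′ j n m d → m + n < f → m + n < f′ → nthZero f n m < j →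
                nthZero f′ n (m + 2 ^ j * d) ≡ nthZero f n m
nthZero-+-2^* (suc f) (suc f′) (suc j) n m d fuel fuel′ z<j with parityView m
nthZero-+-2^* (suc f) (suc f′) (suc j) zero .(q * 2) d _ _ _ | even q
  rewrite *2-+-2^* q j d | nthZero-even-zero f′ (q + 2 ^ j * d) | nthZero-even-zero f q = refl
nthZero-+-2^* (suc f) (suc f′) (suc j) (suc n) .(q * 2) d fuel fuel′ z<j | even q
  rewrite *2-+-2^* q j d | nthZero-even-suc f′ n (q + 2 ^ j * d) | nthZero-even-suc f n q
        | +-suc (q * 2) n =
  cong suc (nthZero-+-2^* f f′ j n q d
    (halve-fuel q n f (s≤s⁻¹ fuel)) (halve-fuel q n f′ (s≤s⁻¹ fuel′)) (s≤s⁻¹ z<j))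
nthZero-+-2^* (suc f) (suc f′) (suc j) n .(1 + q * 2) d fuel fuel′ z<j | odd q
  rewrite *2-+-2^* q j d | nthZero-odd f′ n (q + 2 ^ j * d) | nthZero-odd f n q =
  cong suc (nthZero-+-2^* f f′ j n q d
    (halve-fuel q n f (s≤s⁻¹ fuel)) (halve-fuel q n f′ (s≤s⁻¹ fuel′)) (s≤s⁻¹ z<j))

nthZero-0-≤ : ∀ f j y → y < 2 ^ j → nthZero f 0 y ≤ j
nthZero-0-≤ zero    j y _ = z≤n
nthZero-0-≤ (suc f) j y y<2^j with parityView y
nthZero-0-≤ (suc f) j .(q * 2) _ | even q rewrite nthZero-even-zero f q = z≤n
nthZero-0-≤ (suc f) zero .(1 + q * 2) (s≤s ()) | odd q
nthZero-0-≤ (suc f) (suc j) .(1 + q * 2) y<2^j | odd q rewrite nthZero-odd f 0 q =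
  s≤s (nthZero-0-≤ f j q (halve-< q (2 ^ j) (<-trans (n<1+n _) y<2^j)))

nthZero-1-≤ : ∀ f j y → suc y < 2 ^ j → nthZero f 1 y ≤ j
nthZero-1-≤ _       zero    y (s≤s ())
nthZero-1-≤ zero    (suc j) y _ = s≤s z≤n
nthZero-1-≤ (suc f) (suc j) y y+1<2^j with parityView y
... | even q rewrite nthZero-even-suc f 0 q =
  s≤s (nthZero-0-≤ f j q (halve-< q (2 ^ j) (<-trans (n<1+n _) y+1<2^j)))
... | odd q rewrite nthZero-odd f 1 q =
  s≤s (nthZero-1-≤ f j q (halve-< (suc q) (2 ^ j) y+1<2^j))

2*p∸1≡1+[p∸1]*2 : ∀ p → 0 < p → 2 * p ∸ 1 ≡ 1 + (p ∸ 1) * 2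
2*p∸1≡1+[p∸1]*2 (suc t) _ = t+[1+t+0]≡1+t*2 t
  where t+[1+t+0]≡1+t*2 : ∀ t → t + (suc t + 0) ≡ 1 + t * 2
        t+[1+t+0]≡1+t*2 = solve-∀

nthZero-ones : ∀ f j n → j ≤ f → j ≤ nthZero f n (2 ^ j ∸ 1)
nthZero-ones f       zero    n _ = z≤n
nthZero-ones (suc f) (suc j) n (s≤s j≤f)
  rewrite 2*p∸1≡1+[p∸1]*2 (2 ^ j) (m^n>0 2 j) | nthZero-odd f n (2 ^ j ∸ 1) =
  s≤s (nthZero-ones f j n j≤f)

infixl 7 _/2^_
_/2^_ : ℕ → ℕ → ℕ
m /2^ z = _/_ m (2 ^ z) {{m^n≢0 2 z}}

-- P₂ m unfolds definitionally to roundDown m ∸ 1.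
roundDown : ℕ → ℕ
roundDown m = 2 ^ secondZero m * (m /2^ secondZero m)

P₂[2^n∸1]≡0 : ∀ n → P₂ (2 ^ n ∸ 1) ≡ 0
P₂[2^n∸1]≡0 n = trans (cong (λ q → 2 ^ z * q ∸ 1) m/2^z≡0) (cong (_∸ 1) (*-zeroʳ (2 ^ z)))
  where
  m = 2 ^ n ∸ 1
  z = secondZero m
  m<2^n : m < 2 ^ n
  m<2^n = ∸-monoʳ-< {2 ^ n} (s≤s z≤n) (m^n>0 2 n)
  n≤z : n ≤ z
  n≤z = nthZero-ones (m + 2) n 1 (m≤n⇒m≤n+o 2 (∸-monoˡ-≤ 1 (n<2^n n)))
  m/2^z≡0 : m /2^ z ≡ 0
  m/2^z≡0 = m<n⇒m/n≡0 {{m^n≢0 2 z}} (<-≤-trans m<2^n (^-monoʳ-≤ 2 n≤z))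

secondZero-+-2^* : ∀ m j d → secondZero m < j → secondZero (m + 2 ^ j * d) ≡ secondZero m
secondZero-+-2^* m j d =
  nthZero-+-2^* (m + 2) (m + 2 ^ j * d + 2) j 1 m d m+1<m+2 (<-≤-trans m+1<m+2 (+-monoˡ-≤ 2 (m≤m+n m _)))
  where m+1<m+2 : m + 1 < m + 2
        m+1<m+2 = +-monoʳ-< m ≤-refl

+-*2^-/2^ : ∀ m e z → (m + e * 2 ^ z) /2^ z ≡ m /2^ z + e
+-*2^-/2^ m e z =
  trans (+-distrib-/-∣ʳ m {{m^n≢0 2 z}} (divides-refl e)) (cong (m /2^ z +_) (m*n/n≡m e (2 ^ z) {{m^n≢0 2 z}}))

roundDown-+-2^* : ∀ m j d → secondZero m < j → roundDown (m + 2 ^ j * d) ≡ roundDown m + 2 ^ j * d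
roundDown-+-2^* m j d z<j = begin
  roundDown (m + 2 ^ j * d)
    ≡⟨ cong (λ w → 2 ^ w * ((m + 2 ^ j * d) /2^ w)) (secondZero-+-2^* m j d z<j) ⟩
  2 ^ z * ((m + 2 ^ j * d) /2^ z)    ≡⟨ cong (λ x → 2 ^ z * ((m + x) /2^ z)) 2^j*d≡e*2^z ⟩
  2 ^ z * ((m + e * 2 ^ z) /2^ z)    ≡⟨ cong (2 ^ z *_) (+-*2^-/2^ m e z) ⟩
  2 ^ z * (m /2^ z + e)              ≡⟨ *-distribˡ-+ (2 ^ z) (m /2^ z) e ⟩
  roundDown m + 2 ^ z * e            ≡⟨ cong (roundDown m +_) (trans (*-comm (2 ^ z) e) (sym 2^j*d≡e*2^z)) ⟩
  roundDown m + 2 ^ j * d            ∎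
  where
  open ≡-Reasoning
  z = secondZero m
  o = proj₁ (m≤n⇒∃[o]m+o≡n (<⇒≤ z<j))
  e = 2 ^ o * d
  2^j*d≡e*2^z : 2 ^ j * d ≡ e * 2 ^ z
  2^j*d≡e*2^z = begin
    2 ^ j * d             ≡⟨ cong (λ w → 2 ^ w * d) (sym (proj₂ (m≤n⇒∃[o]m+o≡n (<⇒≤ z<j)))) ⟩
    2 ^ (z + o) * d       ≡⟨ cong (_* d) (^-distribˡ-+-* 2 z o) ⟩
    2 ^ z * 2 ^ o * d     ≡⟨ a*b*c≡b*c*a (2 ^ z) (2 ^ o) d ⟩
    2 ^ o * d * 2 ^ z     ∎
    where a*b*c≡b*c*a : ∀ a b c → a * b * c ≡ b * c * a
          a*b*c≡b*c*a = solve-∀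

P₂-+-2^* : ∀ m j d → secondZero m < j → P₂ (m + 2 ^ j * d) ≡ roundDown m + 2 ^ j * d ∸ 1
P₂-+-2^* m j d z<j = cong (_∸ 1) (roundDown-+-2^* m j d z<j)

ω-pos : ∀ k m → 0 < m → ω k m ≡ m + 2 ^ (k ∸ 1)
ω-pos k (suc m) _ = refl

ω-injective : ∀ k a b → ω k a ≡ ω k b → a ≡ b
ω-injective k zero    zero    _ = refl
ω-injective k (suc a) (suc b) e = +-cancelʳ-≡ (2 ^ (k ∸ 1)) (suc a) (suc b) e

2^n∸1+2^n≡2^[1+n]∸1 : ∀ n → 2 ^ n ∸ 1 + 2 ^ n ≡ 2 ^ suc n ∸ 1
2^n∸1+2^n≡2^[1+n]∸1 n = begin
  2 ^ n ∸ 1 + 2 ^ n       ≡⟨ sym (+-∸-comm (2 ^ n) (m^n>0 2 n)) ⟩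
  2 ^ n + 2 ^ n ∸ 1       ≡⟨ cong (λ x → 2 ^ n + x ∸ 1) (sym (+-identityʳ (2 ^ n))) ⟩
  2 ^ suc n ∸ 1           ∎
  where open ≡-Reasoning

0<IV-b : ∀ j → 0 < IV-b (2 + j)
0<IV-b j = ∸-monoˡ-≤ 1 (*-monoʳ-≤ 2 (m^n>0 2 j))

secondZero-< : ∀ j y → suc y < 2 ^ j → secondZero y < suc j
secondZero-< j y y+1<2^j = s≤s (nthZero-1-≤ (y + 2) j y y+1<2^j)

P₂-+-2^suc : ∀ j y → suc y < 2 ^ j → P₂ (y + 2 ^ suc j) ≡ roundDown y + 2 ^ suc j ∸ 1
P₂-+-2^suc j y y+1<2^j = begin
  P₂ (y + W)          ≡⟨ cong (λ x → P₂ (y + x)) (sym (*-identityʳ W)) ⟩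
  P₂ (y + W * 1)      ≡⟨ P₂-+-2^* y (suc j) 1 (secondZero-< j y y+1<2^j) ⟩
  R + W * 1 ∸ 1       ≡⟨ cong (λ x → R + x ∸ 1) (*-identityʳ W) ⟩
  R + W ∸ 1           ∎
  where
  open ≡-Reasoning
  W = 2 ^ suc j
  R = roundDown y

P₂-+-2^suc-+-2^suc : ∀ j y → suc y < 2 ^ j → P₂ (y + 2 ^ suc j + 2 ^ suc j) ≡ P₂ (y + 2 ^ suc j) + 2 ^ suc j
P₂-+-2^suc-+-2^suc j y y+1<2^j = begin
  P₂ (y + W + W)      ≡⟨ cong P₂ (m+n+n≡m+n*2 y W) ⟩
  P₂ (y + W * 2)      ≡⟨ P₂-+-2^* y (suc j) 2 (secondZero-< j y y+1<2^j) ⟩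
  R + W * 2 ∸ 1       ≡⟨ cong (_∸ 1) (sym (m+n+n≡m+n*2 R W)) ⟩
  R + W + W ∸ 1       ≡⟨ +-∸-comm W (≤-trans (m^n>0 2 (suc j)) (m≤n+m W R)) ⟩
  R + W ∸ 1 + W       ≡⟨ cong (_+ W) (sym (P₂-+-2^suc j y y+1<2^j)) ⟩
  P₂ (y + W) + W      ∎
  where
  open ≡-Reasoning
  W = 2 ^ suc j
  R = roundDown y
  m+n+n≡m+n*2 : ∀ y W → y + W + W ≡ y + W * 2
  m+n+n≡m+n*2 = solve-∀

IV-b≤P₂-+-2^suc : ∀ j y → suc y < 2 ^ j → IV-b (2 + j) ≤ P₂ (y + 2 ^ suc j)
IV-b≤P₂-+-2^suc j y y+1<2^j =
  subst (IV-b (2 + j) ≤_) (sym (P₂-+-2^suc j y y+1<2^j)) (∸-monoˡ-≤ 1 (m≤n+m (2 ^ suc j) (roundDown y)))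

P₂-ω-IV-b : ∀ j → P₂ (ω (2 + j) (IV-b (2 + j))) ≡ ω (2 + j) (P₂ (IV-b (2 + j)))
P₂-ω-IV-b j = begin
  P₂ (ω (2 + j) (IV-b (2 + j)))         ≡⟨ cong P₂ (ω-pos (2 + j) _ (0<IV-b j)) ⟩
  P₂ (2 ^ suc j ∸ 1 + 2 ^ suc j)        ≡⟨ cong P₂ (2^n∸1+2^n≡2^[1+n]∸1 (suc j)) ⟩
  P₂ (2 ^ (2 + j) ∸ 1)                  ≡⟨ P₂[2^n∸1]≡0 (2 + j) ⟩
  0                                     ≡⟨ cong (ω (2 + j)) (sym (P₂[2^n∸1]≡0 (suc j))) ⟩
  ω (2 + j) (P₂ (IV-b (2 + j)))         ∎
  where open ≡-Reasoning

P₂-ω-+-2^suc : ∀ j y → suc y < 2 ^ j → P₂ (ω (2 + j) (y + 2 ^ suc j)) ≡ ω (2 + j) (P₂ (y + 2 ^ suc j))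
P₂-ω-+-2^suc j y y+1<2^j = begin
  P₂ (ω (2 + j) (y + W))   ≡⟨ cong P₂ (ω-pos (2 + j) (y + W) (≤-trans (m^n>0 2 (suc j)) (m≤n+m W y))) ⟩
  P₂ (y + W + W)           ≡⟨ P₂-+-2^suc-+-2^suc j y y+1<2^j ⟩
  P₂ (y + W) + W           ≡⟨ sym (ω-pos (2 + j) _ (<-≤-trans (0<IV-b j) (IV-b≤P₂-+-2^suc j y y+1<2^j))) ⟩
  ω (2 + j) (P₂ (y + W))   ∎
  where
  open ≡-Reasoning
  W = 2 ^ suc j

P₂-ω : ∀ j b → IV-b (2 + j) ≤ b → suc b < 2 ^ suc j + 2 ^ j → P₂ (ω (2 + j) b) ≡ ω (2 + j) (P₂ b)
P₂-ω j b lo≤b b+1<3p with m≤n⇒m<n∨m≡n lo≤b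
... | inj₂ refl = P₂-ω-IV-b j
... | inj₁ lo<b = subst (λ x → P₂ (ω (2 + j) x) ≡ ω (2 + j) (P₂ x)) y+W≡b (P₂-ω-+-2^suc j y y+1<2^j)
  where
  W = 2 ^ suc j
  y = b ∸ W
  y+W≡b : y + W ≡ b
  y+W≡b = m∸n+n≡m (≤-trans (m≤n+m∸n W 1) lo<b)
  y+1<2^j : suc y < 2 ^ j
  y+1<2^j = +-cancelʳ-< W (suc y) (2 ^ j) (begin-strict
    suc (y + W)   ≡⟨ cong suc y+W≡b ⟩
    suc b         <⟨ b+1<3p ⟩
    W + 2 ^ j     ≡⟨ +-comm W (2 ^ j) ⟩
    2 ^ j + W     ∎)
    where open ≤-Reasoning

Box : ℕ → ℕ → Graph
Box k hi = Induced (G k) (Span (IV-b k) hi)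

BoxEdge : ℕ → Color → ℕ → ℕ → Set
BoxEdge lo blue a b = lo ≤ a × b ≡ suc a
BoxEdge lo red  a b = lo ≤ b × a ≡ P₂ b

span⇒≤ : ∀ {lo hi m} → Span lo hi m → m ≤ hi
span⇒≤ (inj₁ refl)    = z≤n
span⇒≤ (inj₂ (_ , h)) = h

span⇒box : ∀ k hi m → hi ≤ I-t k → Span (IV-b k) hi m → Node (Box k hi) m
span⇒box k hi m _     s@(inj₁ m≡0)      = inj₁ m≡0 , s
span⇒box k hi m hi≤t s@(inj₂ (l , h)) = inj₂ (l , ≤-trans h hi≤t) , s

box-edge : ∀ j hi c a b → hi < I-t (2 + j) → Span (IV-b (2 + j)) hi a → Span (IV-b (2 + j)) hi b →
           Edge (Box (2 + j) hi) c a b ⇔ BoxEdge (IV-b (2 + j)) c a b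
box-edge j hi blue a b hi<t sa sb = mk⇔ (λ (((l , _) , e) , _) → l , e) from
  where
  from : BoxEdge (IV-b (2 + j)) blue a b → Edge (Box (2 + j) hi) blue a b
  from (l , refl) = ((l , ≤-trans (span⇒≤ sb) (<⇒≤ hi<t)) , refl) , sa , sb
box-edge j hi red a b hi<t sa sb = mk⇔ (λ (((l , _) , e) , _) → l , e) from
  where
  from : BoxEdge (IV-b (2 + j)) red a b → Edge (Box (2 + j) hi) red a b
  from (l , e) = ((l , ≤-<-trans (span⇒≤ sb) hi<t) , e) , sa , sb

IV-b≤⇔IV-b≤ω : ∀ j a → IV-b (2 + j) ≤ a ⇔ IV-b (3 + j) ≤ ω (2 + j) a
IV-b≤⇔IV-b≤ω j zero    =
  mk⇔ (λ l → contradiction l (<⇒≱ (0<IV-b j))) (λ l → contradiction l (<⇒≱ (0<IV-b (suc j))))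
IV-b≤⇔IV-b≤ω j (suc a) = mk⇔
  (λ l → subst (_≤ suc a + W) lo+W≡lo′ (+-monoˡ-≤ W l))
  (λ l → +-cancelʳ-≤ W _ (suc a) (subst (_≤ suc a + W) (sym lo+W≡lo′) l))
  where
  W = 2 ^ suc j
  lo+W≡lo′ : IV-b (2 + j) + W ≡ IV-b (3 + j)
  lo+W≡lo′ = 2^n∸1+2^n≡2^[1+n]∸1 (suc j)

ω-boxEdge : ∀ j c a b → suc b < 2 ^ suc j + 2 ^ j →
            BoxEdge (IV-b (2 + j)) c a b ⇔ BoxEdge (IV-b (3 + j)) c (ω (2 + j) a) (ω (2 + j) b)
ω-boxEdge j blue zero b _ =
  mk⇔ (λ (l , _) → contradiction l (<⇒≱ (0<IV-b j))) (λ (l , _) → contradiction l (<⇒≱ (0<IV-b (suc j))))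
ω-boxEdge j blue (suc a) b _ = mk⇔
  (λ { (l , refl) → Equivalence.to (IV-b≤⇔IV-b≤ω j (suc a)) l , refl })
  (λ (l , e) → Equivalence.from (IV-b≤⇔IV-b≤ω j (suc a)) l , ω-injective (2 + j) b (suc (suc a)) e)
ω-boxEdge j red a b b+1<3p = mk⇔
  (λ { (l , refl) → Equivalence.to (IV-b≤⇔IV-b≤ω j b) l , sym (P₂-ω j b l b+1<3p) })
  (λ (l , e) → let l′ = Equivalence.from (IV-b≤⇔IV-b≤ω j b) l in
               l′ , ω-injective (2 + j) a (P₂ b) (trans e (P₂-ω j b l′ b+1<3p)))

ω-span : ∀ j hi m → Span (IV-b (2 + j)) hi m → Span (IV-b (3 + j)) (hi + 2 ^ suc j) (ω (2 + j) m)
ω-span j hi zero    _               = inj₁ refl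
ω-span j hi (suc m) (inj₂ (l , h)) =
  inj₂ (Equivalence.to (IV-b≤⇔IV-b≤ω j (suc m)) l , +-monoˡ-≤ (2 ^ suc j) h)

ω-onto : ∀ j hi n → Span (IV-b (3 + j)) (hi + 2 ^ suc j) n →
         ∃ λ m → Span (IV-b (2 + j)) hi m × ω (2 + j) m ≡ n
ω-onto j hi n (inj₁ refl)    = 0 , inj₁ refl , refl
ω-onto j hi n (inj₂ (l , h)) =
  m , inj₂ (lo≤m , m≤hi) , trans (ω-pos (2 + j) m (<-≤-trans (0<IV-b j) lo≤m)) m+W≡n
  where
  W = 2 ^ suc j
  lo = IV-b (2 + j)
  m = n ∸ W
  lo+W≤n : lo + W ≤ n
  lo+W≤n = subst (_≤ n) (sym (2^n∸1+2^n≡2^[1+n]∸1 (suc j))) l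
  m+W≡n : m + W ≡ n
  m+W≡n = m∸n+n≡m (≤-trans (m≤n+m W lo) lo+W≤n)
  lo≤m : lo ≤ m
  lo≤m = +-cancelʳ-≤ W lo m (subst (lo + W ≤_) (sym m+W≡n) lo+W≤n)
  m≤hi : m ≤ hi
  m≤hi = +-cancelʳ-≤ W m hi (subst (_≤ hi + W) (sym m+W≡n) h)

ω-box-iso : ∀ j hi → suc hi < 2 ^ suc j + 2 ^ j →
            IsColorIso (Box (2 + j) hi) (Box (3 + j) (hi + 2 ^ suc j)) (ω (2 + j))
ω-box-iso j hi hi+1<3p =
    (λ m (_ , s) → span⇒box (3 + j) hi′ (ω (2 + j) m) (<⇒≤ hi′<t′) (ω-span j hi m s))
  , (λ a b _ _ → ω-injective (2 + j) a b)
  , (λ n (_ , s′) → let (m , s , e) = ω-onto j hi n s′ in m , span⇒box (2 + j) hi m (<⇒≤ hi<t) s , e)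
  , edges
  where
  W = 2 ^ suc j
  hi′ = hi + W
  hi<t : hi < I-t (2 + j)
  hi<t = ∸-monoˡ-≤ 1 (≤-trans hi+1<3p (+-monoʳ-≤ W (m≤n⇒m≤n+o 0 (^-monoʳ-≤ 2 (n≤1+n j)))))
  hi′<t′ : hi′ < I-t (3 + j)
  hi′<t′ = begin-strict
    hi + W                   <⟨ +-monoˡ-< W hi<t ⟩
    I-t (2 + j) + W          ≤⟨ +-monoʳ-≤ (I-t (2 + j)) (m≤m+n W _) ⟩
    I-t (2 + j) + 2 ^ (2 + j) ≡⟨ 2^n∸1+2^n≡2^[1+n]∸1 (2 + j) ⟩
    I-t (3 + j)              ∎
    where open ≤-Reasoning
  edges : ∀ c a b → Node (Box (2 + j) hi) a → Node (Box (2 + j) hi) b →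
          Edge (Box (2 + j) hi) c a b ⇔ Edge (Box (3 + j) hi′) c (ω (2 + j) a) (ω (2 + j) b)
  edges c a b (_ , sa) (_ , sb) =
    ⇔.trans (box-edge j hi c a b hi<t sa sb)
   (⇔.trans (ω-boxEdge j c a b (≤-<-trans (s≤s (span⇒≤ sb)) hi+1<3p))
            (⇔.sym (box-edge (suc j) hi′ c _ _ hi′<t′ (ω-span j hi a sa) (ω-span j hi b sb))))

II-t≡3*2^∸2 : ∀ i → II-t (4 + i) ≡ 3 * 2 ^ (2 + i) ∸ 2
II-t≡3*2^∸2 i = trans (cong (λ x → x ∸ N ∸ 2) (2*[2*N]≡3*N+N N)) (cong (_∸ 2) (m+n∸n≡m (3 * N) N))
  where
  N = 2 ^ (2 + i)
  2*[2*N]≡3*N+N : ∀ N → 2 * (2 * N) ≡ 3 * N + N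
  2*[2*N]≡3*N+N = solve-∀

2≤3*2^ : ∀ n → 2 ≤ 3 * 2 ^ n
2≤3*2^ n = ≤-trans (s≤s (s≤s z≤n)) (*-monoʳ-≤ 3 (m^n>0 2 n))

II-t-bound : ∀ i → suc (II-t (4 + i)) < 2 ^ (3 + i) + 2 ^ (2 + i)
II-t-bound i = ≤-reflexive (begin
  2 + II-t (4 + i)        ≡⟨ cong (2 +_) (II-t≡3*2^∸2 i) ⟩
  2 + (3 * N ∸ 2)         ≡⟨ m+[n∸m]≡n (2≤3*2^ (2 + i)) ⟩
  3 * N                   ≡⟨ 3*N≡2*N+N N ⟩
  2 * N + N               ∎)
  where
  open ≡-Reasoning
  N = 2 ^ (2 + i)
  3*N≡2*N+N : ∀ N → 3 * N ≡ 2 * N + N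
  3*N≡2*N+N = solve-∀

IV-t≡II-t+2^ : ∀ i → IV-t (5 + i) ≡ II-t (4 + i) + 2 ^ (3 + i)
IV-t≡II-t+2^ i = begin
  2 * (2 * (2 * N)) ∸ 2 * N ∸ N ∸ 2
    ≡⟨ cong (λ x → x ∸ 2 * N ∸ N ∸ 2) (2*[2*[2*N]]≡3*N+2*N+N+2*N N) ⟩
  3 * N + 2 * N + N + 2 * N ∸ 2 * N ∸ N ∸ 2
    ≡⟨ cong (λ x → x ∸ N ∸ 2) (m+n∸n≡m (3 * N + 2 * N + N) (2 * N)) ⟩
  3 * N + 2 * N + N ∸ N ∸ 2           ≡⟨ cong (_∸ 2) (m+n∸n≡m (3 * N + 2 * N) N) ⟩
  3 * N + 2 * N ∸ 2                   ≡⟨ +-∸-comm (2 * N) (2≤3*2^ (2 + i)) ⟩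
  3 * N ∸ 2 + 2 * N                   ≡⟨ cong (_+ 2 * N) (sym (II-t≡3*2^∸2 i)) ⟩
  II-t (4 + i) + 2 * N                ∎
  where
  open ≡-Reasoning
  N = 2 ^ (2 + i)
  2*[2*[2*N]]≡3*N+2*N+N+2*N : ∀ N → 2 * (2 * (2 * N)) ≡ 3 * N + 2 * N + N + 2 * N
  2*[2*[2*N]]≡3*N+2*N+N+2*N = solve-∀

mainTheorem15 : (k : ℕ) → 4 ≤ k → IsColorIso (B₂₃₄ k) (B₄ (k + 1)) (ω k)
mainTheorem15 k@(suc (suc (suc (suc i)))) (s≤s (s≤s (s≤s (s≤s _)))) =
  subst (λ n → IsColorIso (B₂₃₄ k) (B₄ n) (ω k)) (+-comm 1 k)
    (subst (λ hi → IsColorIso (B₂₃₄ k) (Box (suc k) hi) (ω k)) (sym (IV-t≡II-t+2^ i))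
      (ω-box-iso (2 + i) (II-t k) (II-t-bound i)))
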